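{- Let $T=(V,E)$ be a finite tree, $\mathcal{M}\in\{\mathcal{MIN},\mathcal{MAJ}\}$, $c\in\mathcal{P}_{\mathcal{M}}(T)$, and $e=(u,w)\in E$ with $c(u)\ne c(w)$ if $\mathcal{M}=\mathcal{MIN}$ and $c(u)=c(w)$ if $\mathcal{M}=\mathcal{MAJ}$. Let $T_u$ (resp. $T_w$) be the subtree of $T\setminus e$ containing $u$ (resp. $w$). Then $u$ and $w$ have degree at least $3$ in $T$, $T_u$ and $T_w$ contain at least $3$ nodes each, and the restriction of $c$ to each of $T_u$, $T_w$ is a pure 2-cycle of $\mathcal{M}$ on that subtree.
   Context: Colorings are maps $c:V\to\{0,1\}$; $N^i(v)$ is the set of neighbors of $v$ with color $i$. $\mathcal{MIN}(c)(v)=c(v)$ if $|N^{c(v)}(v)|\le|N^{1-c(v)}(v)|$, else $1-c(v)$; $\mathcal{MAJ}(c)(v)=c(v)$ if $|N^{c(v)}(v)|\ge|N^{1-c(v)}(v)|$, else $1-c(v)$. $\mathcal{P}_{\mathcal{M}}(T)$ is the set of pure 2-cycles: colorings $c$ with $\mathcal{M}(\mathcal{M}(c))=c$ and $\mathcal{M}(c)(v)\ne c(v)$ for all $v$. $T\setminus e$ denotes $T$ with edge $e$ removed. -}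

module Defs where

open import Data.Bool using (Bool; true; false; not; _∧_; _∨_; if_then_else_)
open import Data.Nat using (ℕ; zero; suc; _≤_; _≤ᵇ_)
open import Data.Fin using (Fin)
open import Data.Fin.Properties using (_≟_)
open import Data.List using (List; []; _∷_; _++_; length)
open import Data.Bool.ListAction using (any)
open import Data.List.Relation.Unary.Linked using (Linked)
open import Data.List.Relation.Unary.Unique.Propositional using (Unique)
open import Data.Product using (_×_; Σ; ∃)
open import Data.Empty using (⊥)
open import Relation.Nullary using (¬_)
open import Relation.Nullary.Decidable using (⌊_⌋)
open import Relation.Binary.PropositionalEquality using (_≡_; _≢_)
open import Data.List using (allFin)

Adj : ℕ → Set
Adj n = Fin n → Fin n → Bool

VSet : ℕ → Set
VSet n = Fin n → Bool

-- A coloring c : V → {0,1}; colour 1-i is  not i.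
Coloring : ℕ → Set
Coloring n = Fin n → Bool

record SimpleGraph (n : ℕ) : Set where
  field
    adj    : Adj n
    sym    : ∀ x y → adj x y ≡ adj y x
    irrefl : ∀ x → adj x x ≡ false
open SimpleGraph public

count : ∀ {n} → (Fin n → Bool) → ℕ
count {n} p = length (Data.List.filterᵇ p (allFin n))

full : ∀ {n} → VSet n
full _ = true

reachWithin : ∀ {n} → Adj n → ℕ → Fin n → Fin n → Bool
reachWithin A zero    x y = ⌊ x ≟ y ⌋
reachWithin {n} A (suc k) x y =
  reachWithin A k x y ∨ any (λ z → reachWithin A k x z ∧ A z y) (allFin n)

-- connected component of x in A (walks of length ≤ n suffice)
component : ∀ {n} → Adj n → Fin n → VSet n
component {n} A x y = reachWithin A n x y

Connected : ∀ {n} → SimpleGraph n → Set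
Connected {n} G = ∀ x y → component (adj G) x y ≡ true

IsCycle : ∀ {n} → SimpleGraph n → List (Fin n) → Set
IsCycle G [] = ⊥
IsCycle G (x ∷ ys) =
  3 ≤ length (x ∷ ys) × Unique (x ∷ ys) ×
  Linked (λ a b → adj G a b ≡ true) (x ∷ ys ++ x ∷ [])

Acyclic : ∀ {n} → SimpleGraph n → Set
Acyclic G = ∀ xs → ¬ IsCycle G xs

IsTree : ∀ {n} → SimpleGraph n → Set
IsTree G = Connected G × Acyclic G

degree : ∀ {n} → Adj n → Fin n → ℕ
degree A v = count (A v)

removeEdge : ∀ {n} → Adj n → Fin n → Fin n → Adj n
removeEdge A u w x y =
  A x y ∧ not ((⌊ x ≟ u ⌋ ∧ ⌊ y ≟ w ⌋) ∨ (⌊ x ≟ w ⌋ ∧ ⌊ y ≟ u ⌋))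

nbrCount : ∀ {n} → VSet n → Adj n → Coloring n → Fin n → Bool → ℕ
nbrCount S A c v i = count (λ x → S x ∧ A v x ∧ ⌊ Data.Bool._≟_ (c x) i ⌋)

data Rule : Set where
  MIN MAJ : Rule

step : ∀ {n} → Rule → VSet n → Adj n → Coloring n → Coloring n
step MIN S A c v =
  if nbrCount S A c v (c v) ≤ᵇ nbrCount S A c v (not (c v)) then c v else not (c v)
step MAJ S A c v =
  if nbrCount S A c v (not (c v)) ≤ᵇ nbrCount S A c v (c v) then c v else not (c v)

Pure2Cycle : ∀ {n} → Rule → VSet n → Adj n → Coloring n → Set
Pure2Cycle M S A c =
  ∀ v → S v ≡ true → (step M S A (step M S A c) v ≡ c v) × (step M S A c v ≢ c v)

EdgeCond : ∀ {n} → Rule → Coloring n → Fin n → Fin n → Set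
EdgeCond MIN c u w = c u ≢ c w
EdgeCond MAJ c u w = c u ≡ c w

{-# OPTIONS --safe #-}
module Submission where

open import Defs
open import Data.Nat using (ℕ; _≤_)
open import Data.Fin using (Fin)
open import Data.Bool using (Bool; true)
open import Data.Product using (_×_)
open import Relation.Binary.PropositionalEquality using (_≡_)

open import Data.Bool using (false; not; _∧_; _∨_; if_then_else_; T)
open import Data.Bool.Properties
  using (∨-assoc; ∨-idem; ∨-zeroʳ; ∧-zeroʳ; not-¬; ¬-not; not-involutive; T-≡)
open import Data.Bool.ListAction using (any; or)
open import Data.Nat using (zero; suc; _<_; _≤ᵇ_; z≤n; s≤s)
open import Data.Nat.Properties
  using (≤-antisym; ≤-trans; <-≤-trans; ≤-<-trans; m≤n⇒m≤1+n; ≤ᵇ⇒≤; ≤⇒≤ᵇ; <⇒≱; ≰⇒>; <-irrefl)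
open import Data.Fin.Properties using (_≟_; all?; ¬∀⟶∃¬)
open import Data.List using ([]; _∷_; length; filterᵇ; allFin)
open import Data.List.Properties using (length-filter; length-tabulate; map-cong; filter-some)
open import Data.List.Membership.Propositional using (_∈_; lose)
open import Data.List.Membership.Propositional.Properties using (∈-allFin)
open import Data.List.Relation.Unary.Any using (here; there)
open import Data.List.Relation.Unary.Any.Properties using (any⁺)
open import Data.Product using (_,_; proj₁; proj₂)
open import Data.Sum using (_⊎_; inj₁; inj₂)
open import Data.Empty using (⊥-elim)
open import Function using (_∘_)
open import Function.Bundles using (Equivalence)
open import Relation.Nullary using (¬_; Dec; yes; no)
open import Relation.Nullary.Decidable using (⌊_⌋; T?)
open import Relation.Binary.PropositionalEquality
  using (_≢_; refl; trans; cong; subst; subst₂; module ≡-Reasoning)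
import Relation.Binary.PropositionalEquality as ≡

-- A colouring is a pure 2-cycle exactly when every vertex strictly wants to flip: it has more
-- neighbours of its flip colour (its own colour for MIN, the opposite one for MAJ) than of its
-- keep colour. Flipping every vertex exchanges the two colours consistently, so everyone then
-- wants to flip back. The edge e joins keep-coloured neighbours, so deleting it and restricting
-- to a component of T ∖ e only lowers keep counts, while flip-coloured neighbours stay adjacent
-- and hence in the same component. Each endpoint thus has at least one keep neighbour and two
-- flip neighbours, so degree ≥ 3, and its component contains it and those two neighbours.

∧-true⁻ : ∀ {a b} → a ∧ b ≡ true → a ≡ true × b ≡ true
∧-true⁻ {true} {true} _ = refl , refl

∧-true⁺ : ∀ {a b} → a ≡ true → b ≡ true → a ∧ b ≡ true
∧-true⁺ refl refl = refl

∨-true⁻ : ∀ {a b} → a ∨ b ≡ true → a ≡ true ⊎ b ≡ true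
∨-true⁻ {true}  _ = inj₁ refl
∨-true⁻ {false} b = inj₂ b

isYes-true⁻ : ∀ {p} {P : Set p} (d : Dec P) → ⌊ d ⌋ ≡ true → P
isYes-true⁻ (yes p) _ = p

isYes-true⁺ : ∀ {p} {P : Set p} (d : Dec P) → P → ⌊ d ⌋ ≡ true
isYes-true⁺ (yes _) _ = refl
isYes-true⁺ (no ¬p) p = ⊥-elim (¬p p)

isYes-false⁺ : ∀ {p} {P : Set p} (d : Dec P) → ¬ P → ⌊ d ⌋ ≡ false
isYes-false⁺ (yes p) ¬p = ⊥-elim (¬p p)
isYes-false⁺ (no _) _ = refl

isYes-not-≟-not : ∀ a b → ⌊ not a Data.Bool.≟ not b ⌋ ≡ ⌊ a Data.Bool.≟ b ⌋
isYes-not-≟-not false false = refl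
isYes-not-≟-not false true  = refl
isYes-not-≟-not true  false = refl
isYes-not-≟-not true  true  = refl

length-filterᵇ-mono : ∀ {A : Set} {p q : A → Bool} → (∀ x → p x ≡ true → q x ≡ true) →
  ∀ xs → length (filterᵇ p xs) ≤ length (filterᵇ q xs)
length-filterᵇ-mono p⇒q [] = z≤n
length-filterᵇ-mono {p = p} {q} p⇒q (x ∷ xs) with p x in px | q x in qx
... | true  | true  = s≤s (length-filterᵇ-mono p⇒q xs)
... | true  | false with () ← trans (≡.sym qx) (p⇒q x px)
... | false | true  = m≤n⇒m≤1+n (length-filterᵇ-mono p⇒q xs)
... | false | false = length-filterᵇ-mono p⇒q xs

length-filterᵇ-mono-< : ∀ {A : Set} {p q : A → Bool} → (∀ x → p x ≡ true → q x ≡ true) →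
  ∀ {y xs} → y ∈ xs → p y ≡ false → q y ≡ true → length (filterᵇ p xs) < length (filterᵇ q xs)
length-filterᵇ-mono-< p⇒q {xs = x ∷ xs} (here refl) py qy rewrite py | qy =
  s≤s (length-filterᵇ-mono p⇒q xs)
length-filterᵇ-mono-< {p = p} {q} p⇒q {xs = x ∷ xs} (there y∈xs) py qy with p x in px | q x in qx
... | true  | true  = s≤s (length-filterᵇ-mono-< p⇒q y∈xs py qy)
... | true  | false with () ← trans (≡.sym qx) (p⇒q x px)
... | false | true  = m≤n⇒m≤1+n (length-filterᵇ-mono-< p⇒q y∈xs py qy)
... | false | false = length-filterᵇ-mono-< p⇒q y∈xs py qy

module _ {n : ℕ} {p q : Fin n → Bool} where

  count-mono : (∀ x → p x ≡ true → q x ≡ true) → count p ≤ count q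
  count-mono p⇒q = length-filterᵇ-mono p⇒q (allFin n)

  count-mono-< : (∀ x → p x ≡ true → q x ≡ true) →
    ∀ y → p y ≡ false → q y ≡ true → count p < count q
  count-mono-< p⇒q y = length-filterᵇ-mono-< p⇒q (∈-allFin y)

count-cong : ∀ {n} {p q : Fin n → Bool} → (∀ x → p x ≡ q x) → count p ≡ count q
count-cong p≗q = ≤-antisym (count-mono (λ x → trans (≡.sym (p≗q x))))
                           (count-mono (λ x → trans (p≗q x)))

count-pos : ∀ {n} {p : Fin n → Bool} y → p y ≡ true → 0 < count p
count-pos {p = p} y py = filter-some (T? ∘ p) (lose (∈-allFin y) (Equivalence.from T-≡ py))

count≤n : ∀ {n} (p : Fin n → Bool) → count p ≤ n
count≤n {n} p =
  subst (count p ≤_) (length-tabulate {n = n} (λ i → i)) (length-filter (T? ∘ p) (allFin n))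

any-allFin : ∀ {n} (f : Fin n → Bool) y → f y ≡ true → any f (allFin n) ≡ true
any-allFin f y fy =
  Equivalence.to T-≡ (any⁺ f (lose (∈-allFin y) (Equivalence.from T-≡ fy)))

module _ {n : ℕ} (A : Adj n) (x : Fin n) where

  reachWithin-suc : ∀ k y → reachWithin A k x y ≡ true → reachWithin A (suc k) x y ≡ true
  reachWithin-suc k y r rewrite r = refl

  reachWithin-refl : ∀ k → reachWithin A k x x ≡ true
  reachWithin-refl zero    = isYes-true⁺ (x ≟ x) refl
  reachWithin-refl (suc k) = reachWithin-suc k x (reachWithin-refl k)

  ReachStable : ℕ → Set
  ReachStable k = ∀ y → reachWithin A (suc k) x y ≡ reachWithin A k x y

  reachStable? : ∀ k → Dec (ReachStable k)
  reachStable? k = all? (λ y → reachWithin A (suc k) x y Data.Bool.≟ reachWithin A k x y)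

  reachStable-suc : ∀ {k} → ReachStable k → ReachStable (suc k)
  reachStable-suc {k} st y = begin
    R (suc k) y ∨ any (λ z → R (suc k) z ∧ A z y) (allFin n)
      ≡⟨ cong (λ b → R (suc k) y ∨ or b) (map-cong (λ z → cong (_∧ A z y) (st z)) (allFin n)) ⟩
    (R k y ∨ new) ∨ new  ≡⟨ ∨-assoc (R k y) new new ⟩
    R k y ∨ (new ∨ new)  ≡⟨ cong (R k y ∨_) (∨-idem new) ⟩
    R k y ∨ new          ∎
    where
    open ≡-Reasoning
    R : ℕ → Fin n → Bool
    R k = reachWithin A k x
    new : Bool
    new = any (λ z → R k z ∧ A z y) (allFin n)

  unstable⇒count-< : ∀ {k} → ¬ ReachStable k →
    count (reachWithin A k x) < count (reachWithin A (suc k) x)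
  unstable⇒count-< {k} ¬st
    with y , changed ← ¬∀⟶∃¬ n _ (λ y → reachWithin A (suc k) x y Data.Bool.≟ reachWithin A k x y) ¬st
    = count-mono-< (reachWithin-suc k) y old new
    where
    old : reachWithin A k x y ≡ false
    old = ¬-not (λ r → changed (trans (reachWithin-suc k y r) (≡.sym r)))
    new : reachWithin A (suc k) x y ≡ true
    new = ¬-not (λ r → changed (trans r (≡.sym old)))

  reachStable⊎count-≥ : ∀ k → ReachStable k ⊎ suc k ≤ count (reachWithin A k x)
  reachStable⊎count-≥ zero = inj₂ (count-pos x (reachWithin-refl zero))
  reachStable⊎count-≥ (suc k) with reachStable⊎count-≥ k | reachStable? k
  ... | inj₁ st  | _       = inj₁ (reachStable-suc {k} st)
  ... | inj₂ _   | yes st  = inj₁ (reachStable-suc {k} st)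
  ... | inj₂ big | no ¬st = inj₂ (≤-<-trans big (unstable⇒count-< {k} ¬st))

  -- The reached set grows strictly until it stabilises and never exceeds n vertices.
  reachStable-n : ReachStable n
  reachStable-n with reachStable⊎count-≥ n
  ... | inj₁ st  = st
  ... | inj₂ big = ⊥-elim (<-irrefl refl (≤-trans big (count≤n _)))

  component-self : component A x x ≡ true
  component-self = reachWithin-refl n

  component-closed : ∀ {y z} → component A x y ≡ true → A y z ≡ true → component A x z ≡ true
  component-closed {y} {z} r a = begin
    reachWithin A n x z        ≡⟨ reachStable-n z ⟨
    reachWithin A (suc n) x z  ≡⟨ cong (reachWithin A n x z ∨_)
                                    (any-allFin (λ v → reachWithin A n x v ∧ A v z) y (∧-true⁺ r a)) ⟩
    reachWithin A n x z ∨ true ≡⟨ ∨-zeroʳ _ ⟩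
    true                       ∎
    where open ≡-Reasoning

  suc-degree≤count-component : A x x ≡ false → suc (degree A x) ≤ count (component A x)
  suc-degree≤count-component axx =
    count-mono-< (λ _ a → component-closed component-self a) x axx component-self

flipColour : ∀ {n} → Rule → Coloring n → Fin n → Bool
flipColour MIN c v = c v
flipColour MAJ c v = not (c v)

keepColour : ∀ {n} → Rule → Coloring n → Fin n → Bool
keepColour MIN c v = not (c v)
keepColour MAJ c v = c v

flipColour≢keepColour : ∀ {n} M (c : Coloring n) v → flipColour M c v ≢ keepColour M c v
flipColour≢keepColour MIN c v = not-¬ refl
flipColour≢keepColour MAJ c v = not-¬ refl ∘ ≡.sym

WantsFlip : ∀ {n} → Rule → VSet n → Adj n → Coloring n → Fin n → Set
WantsFlip M S A c v = nbrCount S A c v (keepColour M c v) < nbrCount S A c v (flipColour M c v)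

step-≡ : ∀ {n} M (S : VSet n) A c v → step M S A c v ≡
  (if nbrCount S A c v (flipColour M c v) ≤ᵇ nbrCount S A c v (keepColour M c v)
   then c v else not (c v))
step-≡ MIN S A c v = refl
step-≡ MAJ S A c v = refl

if-≤ᵇ-≢⇒> : ∀ m n b → (if m ≤ᵇ n then b else not b) ≢ b → n < m
if-≤ᵇ-≢⇒> m n b ≢b with m ≤ᵇ n in le
... | true  = ⊥-elim (≢b refl)
... | false = ≰⇒> (λ m≤n → subst T le (≤⇒≤ᵇ m≤n))

<⇒if-≤ᵇ≡not : ∀ m n b → n < m → (if m ≤ᵇ n then b else not b) ≡ not b
<⇒if-≤ᵇ≡not m n b n<m with m ≤ᵇ n in le
... | true  = ⊥-elim (<⇒≱ n<m (≤ᵇ⇒≤ m n (subst T (≡.sym le) _)))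
... | false = refl

step-≢⇒wantsFlip : ∀ {n} M (S : VSet n) A c v → step M S A c v ≢ c v → WantsFlip M S A c v
step-≢⇒wantsFlip M S A c v = if-≤ᵇ-≢⇒> _ _ (c v) ∘ subst (_≢ c v) (step-≡ M S A c v)

wantsFlip⇒step-≡not : ∀ {n} M (S : VSet n) A c v → WantsFlip M S A c v → step M S A c v ≡ not (c v)
wantsFlip⇒step-≡not M S A c v wf = trans (step-≡ M S A c v) (<⇒if-≤ᵇ≡not _ _ (c v) wf)

module _ {n : ℕ} (S : VSet n) (A : Adj n) {c c' : Coloring n}
         (complement : ∀ x → S x ≡ true → c' x ≡ not (c x)) where

  nbrCount-complement : ∀ v i → nbrCount S A c' v (not i) ≡ nbrCount S A c v i
  nbrCount-complement v i = count-cong same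
    where
    same : ∀ x → (S x ∧ A v x ∧ ⌊ c' x Data.Bool.≟ not i ⌋) ≡ (S x ∧ A v x ∧ ⌊ c x Data.Bool.≟ i ⌋)
    same x with S x in Sx
    ... | false = refl
    ... | true rewrite complement x Sx = cong (A v x ∧_) (isYes-not-≟-not (c x) i)

  wantsFlip-complement : ∀ M {v} → S v ≡ true → WantsFlip M S A c v → WantsFlip M S A c' v
  wantsFlip-complement MIN {v} Sv wf rewrite complement v Sv =
    subst₂ _<_ (≡.sym (nbrCount-complement v (not (c v)))) (≡.sym (nbrCount-complement v (c v))) wf
  wantsFlip-complement MAJ {v} Sv wf rewrite complement v Sv =
    subst₂ _<_ (≡.sym (nbrCount-complement v (c v))) (≡.sym (nbrCount-complement v (not (c v)))) wf

allWantFlip⇒pure2Cycle : ∀ {n} M (S : VSet n) A (c : Coloring n) →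
  (∀ v → S v ≡ true → WantsFlip M S A c v) → Pure2Cycle M S A c
allWantFlip⇒pure2Cycle M S A c wf v Sv = flipsBack , λ eq → not-¬ eq (flipped v Sv)
  where
  flipped : ∀ x → S x ≡ true → step M S A c x ≡ not (c x)
  flipped x Sx = wantsFlip⇒step-≡not M S A c x (wf x Sx)

  flipsBack : step M S A (step M S A c) v ≡ c v
  flipsBack = begin
    step M S A (step M S A c) v ≡⟨ wantsFlip⇒step-≡not M S A _ v
                                     (wantsFlip-complement S A flipped M Sv (wf v Sv)) ⟩
    not (step M S A c v)        ≡⟨ cong not (flipped v Sv) ⟩
    not (not (c v))             ≡⟨ not-involutive (c v) ⟩
    c v                         ∎
    where open ≡-Reasoning

pure2Cycle⇒wantsFlip : ∀ {n} M (S : VSet n) A (c : Coloring n) →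
  Pure2Cycle M S A c → ∀ v → S v ≡ true → WantsFlip M S A c v
pure2Cycle⇒wantsFlip M S A c pure v Sv = step-≢⇒wantsFlip M S A c v (proj₂ (pure v Sv))

nbrCount-mono : ∀ {n} (S S' : VSet n) (A A' : Adj n) {c : Coloring n} {v i} →
  (∀ x → S x ≡ true → A v x ≡ true → c x ≡ i → S' x ≡ true × A' v x ≡ true) →
  nbrCount S A c v i ≤ nbrCount S' A' c v i
nbrCount-mono S S' A A' {c} {v} {i} h = count-mono λ x Sx∧a∧ci →
  let Sx , a∧ci = ∧-true⁻ {S x} Sx∧a∧ci
      a , ci    = ∧-true⁻ {A v x} a∧ci
      S'x , a'  = h x Sx a (isYes-true⁻ (c x Data.Bool.≟ i) ci)
  in ∧-true⁺ S'x (∧-true⁺ a' ci)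

module _ {n : ℕ} (A : Adj n) (u w : Fin n) where

  removeEdge-⊆ : ∀ {x y} → removeEdge A u w x y ≡ true → A x y ≡ true
  removeEdge-⊆ = proj₁ ∘ ∧-true⁻

  removeEdge-removed : ∀ {x y} → A x y ≡ true → removeEdge A u w x y ≡ false →
    (x ≡ u × y ≡ w) ⊎ (x ≡ w × y ≡ u)
  removeEdge-removed {x} {y} a r rewrite a
    with ∨-true⁻ (trans (≡.sym (not-involutive _)) (cong not r))
  ... | inj₁ xu∧yw = let xu , yw = ∧-true⁻ xu∧yw in
                     inj₁ (isYes-true⁻ (x ≟ u) xu , isYes-true⁻ (y ≟ w) yw)
  ... | inj₂ xw∧yu = let xw , yu = ∧-true⁻ xw∧yu in
                     inj₂ (isYes-true⁻ (x ≟ w) xw , isYes-true⁻ (y ≟ u) yu)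

edgeCond⇒keepColour : ∀ {n} M {c : Coloring n} {u w} → EdgeCond M c u w →
  c w ≡ keepColour M c u × c u ≡ keepColour M c w
edgeCond⇒keepColour MIN c-u≢c-w = ¬-not (c-u≢c-w ∘ ≡.sym) , ¬-not c-u≢c-w
edgeCond⇒keepColour MAJ c-u≡c-w = ≡.sym c-u≡c-w , c-u≡c-w

module _ {n : ℕ} (G : SimpleGraph n) {M : Rule} {c : Coloring n}
         (pure : Pure2Cycle M full (adj G) c) {u w : Fin n} (edgeCond : EdgeCond M c u w) where

  private
    A' : Adj n
    A' = removeEdge (adj G) u w

  wantsFlip : ∀ v → WantsFlip M full (adj G) c v
  wantsFlip v = pure2Cycle⇒wantsFlip M full (adj G) c pure v refl

  flipNeighbour-kept : ∀ {v x} → adj G v x ≡ true → c x ≡ flipColour M c v → A' v x ≡ true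
  flipNeighbour-kept {v} {x} a cx = ¬-not (not-removed ∘ removeEdge-removed (adj G) u w a)
    where
    keep : c w ≡ keepColour M c u × c u ≡ keepColour M c w
    keep = edgeCond⇒keepColour M edgeCond
    not-removed : ¬ ((v ≡ u × x ≡ w) ⊎ (v ≡ w × x ≡ u))
    not-removed (inj₁ (refl , refl)) = flipColour≢keepColour M c u (trans (≡.sym cx) (proj₁ keep))
    not-removed (inj₂ (refl , refl)) = flipColour≢keepColour M c w (trans (≡.sym cx) (proj₂ keep))

  wantsFlip-component : ∀ r {v} → component A' r v ≡ true → WantsFlip M (component A' r) A' c v
  wantsFlip-component r {v} Sv = ≤-<-trans keepCount-≤ (<-≤-trans (wantsFlip v) flipCount-≤)
    where
    keepCount-≤ : nbrCount (component A' r) A' c v (keepColour M c v)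
                ≤ nbrCount full (adj G) c v (keepColour M c v)
    keepCount-≤ = nbrCount-mono (component A' r) full A' (adj G) λ _ _ a' _ →
      refl , removeEdge-⊆ (adj G) u w a'
    flipCount-≤ : nbrCount full (adj G) c v (flipColour M c v)
                ≤ nbrCount (component A' r) A' c v (flipColour M c v)
    flipCount-≤ = nbrCount-mono full (component A' r) (adj G) A' λ _ _ a cx →
      let a' = flipNeighbour-kept a cx in component-closed A' r Sv a' , a'

  pure2Cycle-component : ∀ r → Pure2Cycle M (component A' r) A' c
  pure2Cycle-component r = allWantFlip⇒pure2Cycle M _ A' c λ _ → wantsFlip-component r

  module _ {v o : Fin n} (a : adj G v o ≡ true) (co : c o ≡ keepColour M c v) where

    flipCount≥2 : 2 ≤ nbrCount full (adj G) c v (flipColour M c v)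
    flipCount≥2 = ≤-trans (s≤s (count-pos o (∧-true⁺ a (isYes-true⁺ (c o Data.Bool.≟ _) co))))
                          (wantsFlip v)

    degree≥3 : 3 ≤ degree (adj G) v
    degree≥3 = ≤-trans (s≤s flipCount≥2)
      (count-mono-< (λ _ → proj₁ ∘ ∧-true⁻) o o-not-flip a)
      where
      o-not-flip : adj G v o ∧ ⌊ c o Data.Bool.≟ flipColour M c v ⌋ ≡ false
      o-not-flip rewrite isYes-false⁺ (c o Data.Bool.≟ flipColour M c v)
                           (λ eq → flipColour≢keepColour M c v (trans (≡.sym eq) co))
        = ∧-zeroʳ _

    count-component≥3 : 3 ≤ count (component A' v)
    count-component≥3 = ≤-trans (s≤s (≤-trans flipCount≥2 flipCount≤degree))
      (suc-degree≤count-component A' v A'-irrefl)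
      where
      flipCount≤degree : nbrCount full (adj G) c v (flipColour M c v) ≤ degree A' v
      flipCount≤degree = count-mono λ x a∧cx →
        let a , cx = ∧-true⁻ a∧cx in flipNeighbour-kept a (isYes-true⁻ (c x Data.Bool.≟ _) cx)
      A'-irrefl : A' v v ≡ false
      A'-irrefl rewrite irrefl G v = refl

lemma13 : ∀ {n} (G : SimpleGraph n) → IsTree G → (M : Rule) → (c : Coloring n) →
    Pure2Cycle M full (adj G) c → (u w : Fin n) → adj G u w ≡ true → EdgeCond M c u w →
    (3 ≤ degree (adj G) u) × (3 ≤ degree (adj G) w) ×
    (3 ≤ count (component (removeEdge (adj G) u w) u)) ×
    (3 ≤ count (component (removeEdge (adj G) u w) w)) ×
    Pure2Cycle M (component (removeEdge (adj G) u w) u) (removeEdge (adj G) u w) c ×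
    Pure2Cycle M (component (removeEdge (adj G) u w) w) (removeEdge (adj G) u w) c
lemma13 G _ M c pure u w auw edgeCond =
  degree≥3 G pure edgeCond auw cw-keep , degree≥3 G pure edgeCond awu cu-keep ,
  count-component≥3 G pure edgeCond auw cw-keep , count-component≥3 G pure edgeCond awu cu-keep ,
  pure2Cycle-component G pure edgeCond u , pure2Cycle-component G pure edgeCond w
  where
  cw-keep : c w ≡ keepColour M c u
  cw-keep = proj₁ (edgeCond⇒keepColour M edgeCond)
  cu-keep : c u ≡ keepColour M c w
  cu-keep = proj₂ (edgeCond⇒keepColour M edgeCond)
  awu : adj G w u ≡ true
  awu = trans (SimpleGraph.sym G w u) auw
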